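{- There exists a constant $c > 0$ such that for every Sidon set $A \subset \mathbb{Z}$ one has $|\Sigma^* A| \geq c |A|^3$.
   Context: A set $A \subset \mathbb{Z}$ is a Sidon set if all sums $a_1 + a_2$ with $a_1, a_2 \in A$, $a_1 \le a_2$, are distinct, i.e. $|A+A| = \binom{|A|+1}{2}$. For $A \subseteq \mathbb{Z}$, $\Sigma^* A = \{\sum_{b \in B} b : B \subseteq A\}$ denotes the restricted sumset (sums over all subsets of $A$, including the empty sum $0$). -}

module Defs where

open import Data.Nat using (ℕ)
open import Data.Integer as ℤ using (ℤ; _+_; _≟_)
open import Data.List using (List; []; _∷_; _++_; map; length; deduplicate)
open import Data.List.Membership.Propositional using (_∈_)
open import Data.List.Relation.Unary.Unique.Propositional using (Unique)
open import Data.Product using (_×_)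
open import Data.Sum using (_⊎_)
open import Relation.Binary.PropositionalEquality using (_≡_)

-- A finite set A ⊂ ℤ is represented by a duplicate-free list.
-- Sidon: a₁ + a₂ = b₁ + b₂ (all in A) forces {a₁,a₂} = {b₁,b₂} as multisets,
-- i.e. all sums a₁ + a₂ with a₁ ≤ a₂ are distinct.
IsSidon : List ℤ → Set
IsSidon A = ∀ {a₁ a₂ b₁ b₂} → a₁ ∈ A → a₂ ∈ A → b₁ ∈ A → b₂ ∈ A →
  a₁ + a₂ ≡ b₁ + b₂ → (a₁ ≡ b₁ × a₂ ≡ b₂) ⊎ (a₁ ≡ b₂ × a₂ ≡ b₁)

subsetSums : List ℤ → List ℤ
subsetSums [] = ℤ.+ 0 ∷ []
subsetSums (x ∷ xs) = subsetSums xs ++ map (x +_) (subsetSums xs)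

Σ* : List ℤ → List ℤ
Σ* A = deduplicate _≟_ (subsetSums A)

∣Σ*∣ : List ℤ → ℕ
∣Σ*∣ A = length (Σ* A)

module Submission where

open import Defs
open import Data.Nat using (ℕ; _^_)
open import Data.Integer using (ℤ; +_)
open import Data.Rational using (ℚ; _/_; _*_; _≤_; _<_; 0ℚ)
open import Data.List using (List; length)
open import Data.List.Relation.Unary.Unique.Propositional using (Unique)
open import Data.Product using (∃; _×_)

-- Let Q be a nonnegative Sidon set, listed increasingly as
-- S ++ T ++ D with |S| = |T| = q and |D| ≥ 2q.  Removing x ∈ S from S and
-- adding y ∈ T gives the subset sum ΣS + (y - x); by the Sidon property the
-- q² differences y - x are distinct.  Pairing up the elements of D gives q
-- shifts e = d₁ + d₂, each larger than every sum y + x, so the translates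
--   ΣS + e₁ + ... + eᵢ + (y - x)    (0 ≤ i ≤ q)
-- form q + 1 pairwise disjoint blocks of q² distinct subset sums of Q; hence
-- |Σ*Q| ≥ (q+1)q².  A general Sidon set A has a nonnegative half (its
-- nonnegative elements, or the negatives of its negative elements) of size
-- m ≥ |A|/2 whose subset sums inject into those of A; taking q = ⌊m/4⌋
-- gives |A|³ ≤ 2048 |Σ*A|, i.e. the theorem with c = 1/2048.

open import Function using (_∘_; id)
import Data.Nat as ℕ
open import Data.Nat using (zero; suc; s≤s; z≤n)
import Data.Nat.Properties as ℕₚ
open import Data.Nat.DivMod using (m≡m%n+[m/n]*n; m%n<n; m/n*n≤m) renaming (_/_ to _div_)
import Data.Nat.Tactic.RingSolver as ℕSolver
import Data.Integer as ℤ
open import Data.Integer using (0ℤ; _+_; _-_; -_)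
import Data.Integer.Properties as ℤₚ
open import Data.Integer.Tactic.RingSolver using (solve-∀)
open import Data.List using ([]; _∷_; _++_; map; foldr; filter; cartesianProductWith)
open import Data.List.Properties using (length-map; length-++)
open import Data.List.Membership.Propositional using (_∈_)
open import Data.List.Membership.Propositional.Properties
  using (∈-++⁺ˡ; ∈-++⁺ʳ; ∈-++⁻; ∈-map⁺; ∈-map⁻; ∈-∃++; ∈-filter⁻; ∈-deduplicate⁺; ∈-deduplicate⁻)
import Data.List.Membership.Setoid.Properties as Membershipₛ
open import Data.List.Relation.Unary.Any using (here; there)
open import Data.List.Relation.Unary.All as All using (All; []; _∷_)
import Data.List.Relation.Unary.All.Properties as Allₚ
open import Data.List.Relation.Unary.AllPairs as AllPairs using (AllPairs; []; _∷_)
import Data.List.Relation.Unary.Unique.Propositional.Properties as Uniqueₚ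
open import Data.List.Relation.Unary.Unique.DecPropositional.Properties using (deduplicate-!)
open import Data.List.Relation.Binary.Subset.Propositional using (_⊆_)
open import Data.List.Relation.Binary.Subset.Propositional.Properties using (xs⊆xs++ys; ++⁺ʳ)
open import Data.List.Relation.Binary.Sublist.Propositional using ([]; _∷_; _∷ʳ_) renaming (_⊆_ to _⊑_)
open import Data.List.Relation.Binary.Sublist.Propositional.Properties using (filter-⊆)
open import Data.List.Relation.Binary.Disjoint.Propositional using (Disjoint)
open import Data.List.Relation.Binary.Permutation.Propositional as ↭ using (_↭_; prep; swap; ↭-sym; ↭⇒↭ₛ)
open import Data.List.Relation.Binary.Permutation.Propositional.Properties using (shift; ↭-length; ∈-resp-↭)
import Data.List.Relation.Binary.Permutation.Setoid.Properties as Permutationₛ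
open import Data.List.Relation.Unary.Sorted.TotalOrder.Properties using (Sorted⇒AllPairs)
open import Relation.Binary.Bundles using (DecTotalOrder)
open import Data.Product using (∃₂; _,_; proj₁; proj₂)
open import Data.Sum as Sum using (_⊎_; inj₁; inj₂)
open import Relation.Nullary using (yes; no; contradiction)
open import Relation.Unary using (Decidable)
open import Relation.Unary.Properties using (∁?)
open import Relation.Binary.PropositionalEquality
  using (_≡_; refl; sym; trans; cong; cong₂; subst; subst₂; setoid; module ≡-Reasoning)
open import Data.Rational using (mkℚ)
import Data.Rational as ℚ
open import Data.Rational.Properties using (normalize-coprime; toℚᵘ-cancel-≤; toℚᵘ-homo-*)
import Data.Rational.Unnormalised as ℚᵘ
import Data.Rational.Unnormalised.Properties as ℚᵘₚ
open import Data.Nat.Coprimality using (1-coprimeTo) renaming (sym to coprime-sym)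

module _ {A : Set} where

  unique-length-≤ : ∀ {L D : List A} → Unique L → L ⊆ D → length L ℕ.≤ length D
  unique-length-≤ {[]} _ _ = z≤n
  unique-length-≤ {x ∷ L} (x∉L ∷ uL) L⊆D with ∈-∃++ (L⊆D (here refl))
  ... | D₁ , D₂ , refl =
    ℕₚ.≤-trans (s≤s (unique-length-≤ uL L⊆D₁++D₂)) (ℕₚ.≤-reflexive (↭-length (↭-sym (shift x D₁ D₂))))
    where
    L⊆D₁++D₂ : L ⊆ D₁ ++ D₂
    L⊆D₁++D₂ v∈L with ∈-resp-↭ (shift x D₁ D₂) (L⊆D (there v∈L))
    ... | here v≡x = contradiction (sym v≡x) (All.lookup x∉L v∈L)
    ... | there v∈D₁++D₂ = v∈D₁++D₂

  -- A map which is injective on the elements of a list preserves uniqueness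
  -- (the library version asks for injectivity everywhere).
  map-unique : ∀ {B : Set} (f : A → B) {xs : List A} → Unique xs →
               (∀ {a a′} → a ∈ xs → a′ ∈ xs → f a ≡ f a′ → a ≡ a′) → Unique (map f xs)
  map-unique f [] _ = []
  map-unique f (x∉xs ∷ uxs) inj =
    Allₚ.map⁺ (All.tabulate λ a∈xs fx≡fa → All.lookup x∉xs a∈xs (inj (here refl) (there a∈xs) fx≡fa))
    ∷ map-unique f uxs (λ a∈ a′∈ → inj (there a∈) (there a′∈))

  split-at : ∀ n {k} (xs : List A) → n ℕ.+ k ℕ.≤ length xs →
             ∃₂ λ P R → xs ≡ P ++ R × length P ≡ n × k ℕ.≤ length R
  split-at zero xs h = [] , xs , refl , refl , h
  split-at (suc n) (x ∷ xs) (s≤s h) with split-at n xs h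
  ... | P , R , refl , |P| , k≤|R| = x ∷ P , R , refl , cong suc |P| , k≤|R|

  AllPairs-++⁻ : ∀ {R : A → A → Set} xs {ys} → AllPairs R (xs ++ ys) →
                 AllPairs R xs × AllPairs R ys × (∀ {x y} → x ∈ xs → y ∈ ys → R x y)
  AllPairs-++⁻ [] pairs = [] , pairs , λ ()
  AllPairs-++⁻ {R} (x ∷ xs) {ys} (x-rel ∷ pairs) with AllPairs-++⁻ xs pairs
  ... | pairs-xs , pairs-ys , across = Allₚ.++⁻ˡ xs x-rel ∷ pairs-xs , pairs-ys , across′
    where
    across′ : ∀ {u y} → u ∈ x ∷ xs → y ∈ ys → R u y
    across′ (here refl) y∈ys = All.lookup (Allₚ.++⁻ʳ xs x-rel) y∈ys
    across′ (there u∈xs) y∈ys = across u∈xs y∈ys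

module _ {A B C : Set} (f : A → B → C) where

  length-cartesianProductWith : ∀ xs ys →
    length (cartesianProductWith f xs ys) ≡ length xs ℕ.* length ys
  length-cartesianProductWith [] ys = refl
  length-cartesianProductWith (x ∷ xs) ys = begin
      length (map (f x) ys ++ cartesianProductWith f xs ys)
    ≡⟨ length-++ (map (f x) ys) ⟩
      length (map (f x) ys) ℕ.+ length (cartesianProductWith f xs ys)
    ≡⟨ cong₂ ℕ._+_ (length-map (f x) ys) (length-cartesianProductWith xs ys) ⟩
      length ys ℕ.+ length xs ℕ.* length ys
    ∎
    where open ≡-Reasoning

  ∈-cartesianProductWith⁻ : ∀ xs ys {v} → v ∈ cartesianProductWith f xs ys →
                            ∃₂ λ a b → a ∈ xs × b ∈ ys × v ≡ f a b
  ∈-cartesianProductWith⁻ = Membershipₛ.∈-cartesianProductWith⁻ (setoid A) (setoid B) (setoid C) f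

  -- The values f a b (a ∈ xs, b ∈ ys) are distinct as soon as f is injective
  -- on xs × ys; this is where the Sidon property will enter.
  cartesianProductWith-unique : ∀ {xs ys} → Unique xs → Unique ys →
    (∀ {a a′ b b′} → a ∈ xs → a′ ∈ xs → b ∈ ys → b′ ∈ ys → f a b ≡ f a′ b′ → a ≡ a′ × b ≡ b′) →
    Unique (cartesianProductWith f xs ys)
  cartesianProductWith-unique [] _ _ = []
  cartesianProductWith-unique {x ∷ xs} {ys} (x∉xs ∷ uxs) uys inj =
    Uniqueₚ.++⁺ (map-unique (f x) uys (λ b∈ b′∈ → proj₂ ∘ inj (here refl) (here refl) b∈ b′∈))
                (cartesianProductWith-unique uxs uys (λ a∈ a′∈ → inj (there a∈) (there a′∈)))
                disjoint
    where
    disjoint : Disjoint (map (f x) ys) (cartesianProductWith f xs ys)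
    disjoint (v∈row , v∈rest) with ∈-map⁻ (f x) v∈row | ∈-cartesianProductWith⁻ xs ys v∈rest
    ... | b , b∈ys , refl | a , b′ , a∈xs , b′∈ys , fxb≡fab′ =
      All.lookup x∉xs a∈xs (proj₁ (inj (here refl) (there a∈xs) b∈ys b′∈ys fxb≡fab′))

skip : ∀ x xs {v} → v ∈ subsetSums xs → v ∈ subsetSums (x ∷ xs)
skip x xs = ∈-++⁺ˡ

keep : ∀ x xs {v} → v ∈ subsetSums xs → x + v ∈ subsetSums (x ∷ xs)
keep x xs v∈ = ∈-++⁺ʳ (subsetSums xs) (∈-map⁺ (λ w → x + w) v∈)

subsetSums-∷⁻ : ∀ x xs {v} → v ∈ subsetSums (x ∷ xs) →
                v ∈ subsetSums xs ⊎ ∃ λ w → w ∈ subsetSums xs × v ≡ x + w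
subsetSums-∷⁻ x xs v∈ with ∈-++⁻ (subsetSums xs) v∈
... | inj₁ v∈xs = inj₁ v∈xs
... | inj₂ v∈shifted = inj₂ (∈-map⁻ (λ w → x + w) v∈shifted)

0∈subsetSums : ∀ xs → 0ℤ ∈ subsetSums xs
0∈subsetSums [] = here refl
0∈subsetSums (x ∷ xs) = skip x xs (0∈subsetSums xs)

∈⇒∈subsetSums : ∀ {x xs} → x ∈ xs → x ∈ subsetSums xs
∈⇒∈subsetSums {x} {.x ∷ xs} (here refl) = subst (_∈ subsetSums (x ∷ xs)) (ℤₚ.+-identityʳ x) (keep x xs (0∈subsetSums xs))
∈⇒∈subsetSums {x} {y ∷ xs} (there x∈xs) = skip y xs (∈⇒∈subsetSums x∈xs)

sumℤ : List ℤ → ℤ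
sumℤ = foldr _+_ 0ℤ

sum∈subsetSums : ∀ xs → sumℤ xs ∈ subsetSums xs
sum∈subsetSums [] = here refl
sum∈subsetSums (x ∷ xs) = keep x xs (sum∈subsetSums xs)

sum-minus∈subsetSums : ∀ {x S} → x ∈ S → sumℤ S - x ∈ subsetSums S
sum-minus∈subsetSums {x} {.x ∷ S} (here refl) =
  subst (_∈ subsetSums (x ∷ S)) (cancel x (sumℤ S)) (skip x S (sum∈subsetSums S))
  where
  cancel : ∀ x s → s ≡ x + s - x
  cancel = solve-∀
sum-minus∈subsetSums {x} {y ∷ S} (there x∈S) =
  subst (_∈ subsetSums (y ∷ S)) (reassoc y (sumℤ S) x) (keep y S (sum-minus∈subsetSums x∈S))
  where
  reassoc : ∀ y s x → y + (s - x) ≡ y + s - x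
  reassoc = solve-∀

subsetSums-++ : ∀ P {Q u w} → u ∈ subsetSums P → w ∈ subsetSums Q → u + w ∈ subsetSums (P ++ Q)
subsetSums-++ [] {w = w} (here refl) w∈ = subst (_∈ _) (sym (ℤₚ.+-identityˡ w)) w∈
subsetSums-++ (x ∷ P) {Q} u∈ w∈ with subsetSums-∷⁻ x P u∈
... | inj₁ u∈P = skip x (P ++ Q) (subsetSums-++ P u∈P w∈)
... | inj₂ (u , u∈P , refl) = subst (_∈ _) (sym (ℤₚ.+-assoc x u _)) (keep x (P ++ Q) (subsetSums-++ P u∈P w∈))

subsetSums-∷-mono : ∀ x {xs ys} → subsetSums xs ⊆ subsetSums ys → subsetSums (x ∷ xs) ⊆ subsetSums (x ∷ ys)
subsetSums-∷-mono x {xs} {ys} sub v∈ with subsetSums-∷⁻ x xs v∈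
... | inj₁ v∈xs = skip x ys (sub v∈xs)
... | inj₂ (w , w∈xs , refl) = keep x ys (sub w∈xs)

subsetSums-swap : ∀ x y xs → subsetSums (x ∷ y ∷ xs) ⊆ subsetSums (y ∷ x ∷ xs)
subsetSums-swap x y xs v∈ with subsetSums-∷⁻ x (y ∷ xs) v∈
... | inj₁ v∈yxs with subsetSums-∷⁻ y xs v∈yxs
...   | inj₁ v∈xs = skip y (x ∷ xs) (skip x xs v∈xs)
...   | inj₂ (w , w∈xs , refl) = keep y (x ∷ xs) (skip x xs w∈xs)
subsetSums-swap x y xs v∈ | inj₂ (u , u∈yxs , refl) with subsetSums-∷⁻ y xs u∈yxs
...   | inj₁ u∈xs = skip y (x ∷ xs) (keep x xs u∈xs)
...   | inj₂ (w , w∈xs , refl) = subst (_∈ _) (exchange x y w) (keep y (x ∷ xs) (keep x xs w∈xs))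
  where
  exchange : ∀ x y w → y + (x + w) ≡ x + (y + w)
  exchange = solve-∀

subsetSums-↭ : ∀ {xs ys} → xs ↭ ys → subsetSums xs ⊆ subsetSums ys
subsetSums-↭ ↭.refl v∈ = v∈
subsetSums-↭ {x ∷ xs} {x ∷ ys} (prep x σ) = subsetSums-∷-mono x {xs} {ys} (subsetSums-↭ σ)
subsetSums-↭ {x ∷ y ∷ xs} {y ∷ x ∷ ys} (swap x y σ) v∈ =
  subsetSums-swap x y ys (subsetSums-∷-mono x {y ∷ xs} {y ∷ ys} (subsetSums-∷-mono y {xs} {ys} (subsetSums-↭ σ)) v∈)
subsetSums-↭ (↭.trans σ τ) v∈ = subsetSums-↭ τ (subsetSums-↭ σ v∈)

subsetSums-⊑ : ∀ {xs ys} → xs ⊑ ys → subsetSums xs ⊆ subsetSums ys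
subsetSums-⊑ [] v∈ = v∈
subsetSums-⊑ {ys = y ∷ ys} (y ∷ʳ σ) v∈ = skip y ys (subsetSums-⊑ σ v∈)
subsetSums-⊑ {x ∷ xs} {x ∷ ys} (refl ∷ σ) = subsetSums-∷-mono x {xs} {ys} (subsetSums-⊑ σ)

subsetSums-neg : ∀ xs {v} → v ∈ subsetSums (map -_ xs) → - v ∈ subsetSums xs
subsetSums-neg [] (here refl) = here refl
subsetSums-neg (x ∷ xs) v∈ with subsetSums-∷⁻ (- x) (map -_ xs) v∈
... | inj₁ v∈xs = skip x xs (subsetSums-neg xs v∈xs)
... | inj₂ (w , w∈xs , refl) = subst (_∈ _) (negate x w) (keep x xs (subsetSums-neg xs w∈xs))
  where
  negate : ∀ x w → x + - w ≡ - (- x + w)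
  negate = solve-∀

∣Σ*∣-lower : ∀ {L A} → Unique L → L ⊆ subsetSums A → length L ℕ.≤ ∣Σ*∣ A
∣Σ*∣-lower uL L⊆ = unique-length-≤ uL (∈-deduplicate⁺ ℤ._≟_ ∘ L⊆)

∣Σ*∣-positive : ∀ A → 1 ℕ.≤ ∣Σ*∣ A
∣Σ*∣-positive A = ∣Σ*∣-lower {A = A} ([] ∷ []) λ { (here refl) → 0∈subsetSums A }

∣Σ*∣-mono : ∀ {A B} (f : ℤ → ℤ) → (∀ {u v} → f u ≡ f v → u ≡ v) →
            (∀ {v} → v ∈ subsetSums B → f v ∈ subsetSums A) → ∣Σ*∣ B ℕ.≤ ∣Σ*∣ A
∣Σ*∣-mono {A} {B} f f-inj f-maps =
  subst (ℕ._≤ ∣Σ*∣ A) (length-map f (Σ* B))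
    (∣Σ*∣-lower {A = A} (Uniqueₚ.map⁺ f-inj (deduplicate-! ℤ._≟_ (subsetSums B))) image⊆)
  where
  image⊆ : map f (Σ* B) ⊆ subsetSums A
  image⊆ v∈ with ∈-map⁻ f v∈
  ... | w , w∈ , refl = f-maps (∈-deduplicate⁻ ℤ._≟_ (subsetSums B) w∈)

sidon-⊆ : ∀ {xs ys} → ys ⊆ xs → IsSidon xs → IsSidon ys
sidon-⊆ ys⊆xs sidon a₁∈ a₂∈ b₁∈ b₂∈ = sidon (ys⊆xs a₁∈) (ys⊆xs a₂∈) (ys⊆xs b₁∈) (ys⊆xs b₂∈)

neg-sum-cancel : ∀ a₁ a₂ b₁ b₂ → - a₁ + - a₂ ≡ - b₁ + - b₂ → a₁ + a₂ ≡ b₁ + b₂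
neg-sum-cancel a₁ a₂ b₁ b₂ eq = ℤₚ.neg-injective (begin
    - (a₁ + a₂)   ≡⟨ ℤₚ.neg-distrib-+ a₁ a₂ ⟩
    - a₁ + - a₂   ≡⟨ eq ⟩
    - b₁ + - b₂   ≡⟨ sym (ℤₚ.neg-distrib-+ b₁ b₂) ⟩
    - (b₁ + b₂)   ∎)
  where open ≡-Reasoning

sidon-neg : ∀ {xs} → IsSidon xs → IsSidon (map -_ xs)
sidon-neg sidon a₁∈ a₂∈ b₁∈ b₂∈ eq
  with ∈-map⁻ -_ a₁∈ | ∈-map⁻ -_ a₂∈ | ∈-map⁻ -_ b₁∈ | ∈-map⁻ -_ b₂∈
... | a₁ , a₁∈xs , refl | a₂ , a₂∈xs , refl | b₁ , b₁∈xs , refl | b₂ , b₂∈xs , refl =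
  Sum.map negate-both negate-both (sidon a₁∈xs a₂∈xs b₁∈xs b₂∈xs (neg-sum-cancel a₁ a₂ b₁ b₂ eq))
  where
  negate-both : ∀ {a b c d} → a ≡ b × c ≡ d → - a ≡ - b × - c ≡ - d
  negate-both (refl , refl) = refl , refl

-- The differences y - x (x ∈ S, y ∈ T) are pairwise distinct, stated
-- additively: y + x′ = y′ + x forces x = x′ and y = y′.
DistinctDifferences : List ℤ → List ℤ → Set
DistinctDifferences S T = ∀ {x x′ y y′} → x ∈ S → x′ ∈ S → y ∈ T → y′ ∈ T →
                          y + x′ ≡ y′ + x → x ≡ x′ × y ≡ y′

-- For disjoint S, T inside a Sidon set, the only other solution y = x of
-- y + x′ = y′ + x is excluded.
sidon⇒distinct-differences : ∀ {S T} → IsSidon (S ++ T) → Disjoint S T → DistinctDifferences S T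
sidon⇒distinct-differences {S} sidon S#T x∈ x′∈ y∈ y′∈ eq
  with sidon (∈-++⁺ʳ S y∈) (∈-++⁺ˡ x′∈) (∈-++⁺ʳ S y′∈) (∈-++⁺ˡ x∈) eq
... | inj₁ (y≡y′ , x′≡x) = sym x′≡x , y≡y′
... | inj₂ (refl , _) = contradiction (x∈ , y∈) S#T

Nonneg : List ℤ → Set
Nonneg xs = ∀ {x} → x ∈ xs → 0ℤ ℤ.≤ x

pairSums : List ℤ → List ℤ
pairSums [] = []
pairSums (_ ∷ []) = []
pairSums (d₁ ∷ d₂ ∷ D) = d₁ + d₂ ∷ pairSums D

pairSums-length : ∀ q D → q ℕ.+ q ℕ.≤ length D → q ℕ.≤ length (pairSums D)
pairSums-length zero D _ = z≤n
pairSums-length (suc q) (d ∷ []) (s≤s h) = contradiction (ℕₚ.≤-trans (ℕₚ.m≤n+m (suc q) q) h) λ ()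
pairSums-length (suc q) (d₁ ∷ d₂ ∷ D) (s≤s h) =
  s≤s (pairSums-length q D (ℕₚ.≤-pred (subst (ℕ._≤ suc (length D)) (ℕₚ.+-suc q q) h)))

pairSums-subsetSums : ∀ D → subsetSums (pairSums D) ⊆ subsetSums D
pairSums-subsetSums [] v∈ = v∈
pairSums-subsetSums (d ∷ []) v∈ = skip d [] v∈
pairSums-subsetSums (d₁ ∷ d₂ ∷ D) v∈ with subsetSums-∷⁻ (d₁ + d₂) (pairSums D) v∈
... | inj₁ v∈D = skip d₁ (d₂ ∷ D) (skip d₂ D (pairSums-subsetSums D v∈D))
... | inj₂ (w , w∈ , refl) =
  subst (_∈ _) (sym (ℤₚ.+-assoc d₁ d₂ w)) (keep d₁ (d₂ ∷ D) (keep d₂ D (pairSums-subsetSums D w∈)))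

module Blocks (S T : List ℤ) where

  translates : ℤ → List ℤ
  translates b = cartesianProductWith (λ x y → b + (y - x)) S T

  -- A shift e separates consecutive blocks when it exceeds every y + x.
  Spread : ℤ → Set
  Spread e = 0ℤ ℤ.≤ e × (∀ {x y} → x ∈ S → y ∈ T → y + x ℤ.< e)

  blocks : ℤ → List ℤ → List ℤ
  blocks b [] = translates b
  blocks b (e ∷ E) = translates b ++ blocks (b + e) E

  translates-∈⁻ : ∀ b {v} → v ∈ translates b → ∃₂ λ x y → x ∈ S × y ∈ T × v ≡ b + (y - x)
  translates-∈⁻ b = ∈-cartesianProductWith⁻ (λ x y → b + (y - x)) S T

  blocks-length : ∀ b E → length (blocks b E) ≡ suc (length E) ℕ.* (length S ℕ.* length T)
  blocks-length b [] =
    trans (length-cartesianProductWith _ S T) (sym (ℕₚ.+-identityʳ _))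
  blocks-length b (e ∷ E) = begin
      length (translates b ++ blocks (b + e) E)
    ≡⟨ length-++ (translates b) ⟩
      length (translates b) ℕ.+ length (blocks (b + e) E)
    ≡⟨ cong₂ ℕ._+_ (length-cartesianProductWith _ S T) (blocks-length (b + e) E) ⟩
      length S ℕ.* length T ℕ.+ suc (length E) ℕ.* (length S ℕ.* length T)
    ∎
    where open ≡-Reasoning

  translate-cross : ∀ b x x′ y y′ → b + (y - x) ≡ b + (y′ - x′) → y + x′ ≡ y′ + x
  translate-cross b x x′ y y′ eq = begin
      y + x′                            ≡⟨ expand b x x′ y ⟩
      b + (y - x) - b + (x + x′)        ≡⟨ cong (λ t → t - b + (x + x′)) eq ⟩
      b + (y′ - x′) - b + (x + x′)      ≡⟨ contract b x x′ y′ ⟩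
      y′ + x                            ∎
    where
    open ≡-Reasoning
    expand : ∀ b x x′ y → y + x′ ≡ b + (y - x) - b + (x + x′)
    expand = solve-∀
    contract : ∀ b x x′ y′ → b + (y′ - x′) - b + (x + x′) ≡ y′ + x
    contract = solve-∀

  translates-unique : ∀ b → Unique S → Unique T → DistinctDifferences S T → Unique (translates b)
  translates-unique b uS uT distinct = cartesianProductWith-unique (λ x y → b + (y - x)) uS uT
    λ {x} {x′} {y} {y′} x∈ x′∈ y∈ y′∈ eq → distinct x∈ x′∈ y∈ y′∈ (translate-cross b x x′ y y′ eq)

  translates-upper : ∀ b {v} → Nonneg S → v ∈ translates b → ∃ λ y → y ∈ T × v ℤ.≤ b + y
  translates-upper b S≥0 v∈ with translates-∈⁻ b v∈
  ... | x , y , x∈ , y∈ , refl = y , y∈ , ℤₚ.+-monoʳ-≤ b (ℤₚ.i-j≤i y x {{ℤ.nonNegative (S≥0 x∈)}})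

  translates-lower : ∀ b {v} → Nonneg T → v ∈ translates b → ∃ λ x → x ∈ S × b ℤ.≤ v + x
  translates-lower b T≥0 v∈ with translates-∈⁻ b v∈
  ... | x , y , x∈ , y∈ , refl =
    x , x∈ , subst (b ℤ.≤_) (add-back b x y) (ℤₚ.i≤i+j b y {{ℤ.nonNegative (T≥0 y∈)}})
    where
    add-back : ∀ b x y → b + y ≡ b + (y - x) + x
    add-back = solve-∀

  -- Since the shifts are nonnegative, later blocks obey the same lower bound.
  blocks-lower : ∀ b E {v} → Nonneg T → All Spread E → v ∈ blocks b E → ∃ λ x → x ∈ S × b ℤ.≤ v + x
  blocks-lower b [] T≥0 _ v∈ = translates-lower b T≥0 v∈
  blocks-lower b (e ∷ E) T≥0 ((e≥0 , _) ∷ spreads) v∈ with ∈-++⁻ (translates b) v∈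
  ... | inj₁ v∈first = translates-lower b T≥0 v∈first
  ... | inj₂ v∈rest with blocks-lower (b + e) E T≥0 spreads v∈rest
  ...   | x , x∈ , b+e≤v+x = x , x∈ , ℤₚ.≤-trans (ℤₚ.i≤i+j b e {{ℤ.nonNegative e≥0}}) b+e≤v+x

  -- The blocks are pairwise disjoint: everything in the first block is at
  -- most b + y, everything later at least b + e - x, and y + x < e.
  blocks-unique : ∀ b E → Unique S → Unique T → DistinctDifferences S T →
                  Nonneg S → Nonneg T → All Spread E → Unique (blocks b E)
  blocks-unique b [] uS uT distinct _ _ _ = translates-unique b uS uT distinct
  blocks-unique b (e ∷ E) uS uT distinct S≥0 T≥0 ((_ , e-spread) ∷ spreads) =
    Uniqueₚ.++⁺ (translates-unique b uS uT distinct)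
                (blocks-unique (b + e) E uS uT distinct S≥0 T≥0 spreads)
                separated
    where
    separated : Disjoint (translates b) (blocks (b + e) E)
    separated {v} (v∈first , v∈rest) with translates-upper b S≥0 v∈first | blocks-lower (b + e) E T≥0 spreads v∈rest
    ... | y , y∈ , v≤b+y | x , x∈ , b+e≤v+x = ℤₚ.<-irrefl refl (begin-strict
        b + e          ≤⟨ b+e≤v+x ⟩
        v + x          ≤⟨ ℤₚ.+-monoˡ-≤ x v≤b+y ⟩
        b + y + x      ≡⟨ ℤₚ.+-assoc b y x ⟩
        b + (y + x)    <⟨ ℤₚ.+-monoʳ-< b (e-spread x∈ y∈) ⟩
        b + e          ∎)
      where open ℤₚ.≤-Reasoning

  pairSums-spread : ∀ D → Nonneg D → (∀ {x d} → x ∈ S → d ∈ D → x ℤ.< d) →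
                    (∀ {y d} → y ∈ T → d ∈ D → y ℤ.< d) → All Spread (pairSums D)
  pairSums-spread [] _ _ _ = []
  pairSums-spread (d ∷ []) _ _ _ = []
  pairSums-spread (d₁ ∷ d₂ ∷ D) D≥0 S<D T<D =
    (ℤₚ.+-mono-≤ (D≥0 (here refl)) (D≥0 (there (here refl))) ,
     λ x∈ y∈ → ℤₚ.+-mono-< (T<D y∈ (here refl)) (S<D x∈ (there (here refl))))
    ∷ pairSums-spread D (D≥0 ∘ there ∘ there) (λ x∈ → S<D x∈ ∘ there ∘ there) (λ y∈ → T<D y∈ ∘ there ∘ there)

  Realizable : List ℤ → ℤ → List ℤ → Set
  Realizable U b E = ∀ {x y z} → x ∈ S → y ∈ T → z ∈ subsetSums E → b + (y - x) + z ∈ subsetSums U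

  translates-⊆ : ∀ U b E → Realizable U b E → translates b ⊆ subsetSums U
  translates-⊆ U b E realizable v∈ with translates-∈⁻ b v∈
  ... | x , y , x∈ , y∈ , refl =
    subst (_∈ subsetSums U) (ℤₚ.+-identityʳ _) (realizable x∈ y∈ (0∈subsetSums E))

  blocks-⊆ : ∀ U b E → Realizable U b E → blocks b E ⊆ subsetSums U
  blocks-⊆ U b [] realizable = translates-⊆ U b [] realizable
  blocks-⊆ U b (e ∷ E) realizable v∈ with ∈-++⁻ (translates b) v∈
  ... | inj₁ v∈first = translates-⊆ U b (e ∷ E) realizable v∈first
  ... | inj₂ v∈rest = blocks-⊆ U (b + e) E realizable′ v∈rest
    where
    regroup : ∀ b e x y z → b + (y - x) + (e + z) ≡ b + e + (y - x) + z
    regroup = solve-∀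
    realizable′ : Realizable U (b + e) E
    realizable′ {x} {y} {z} x∈ y∈ z∈ =
      subst (_∈ subsetSums U) (regroup b e x y z) (realizable x∈ y∈ (keep e E z∈))

  -- Starting from b = ΣS: b - x + y + z is the sum of (S minus x), y and z.
  sum-realizable : ∀ {D E} → subsetSums E ⊆ subsetSums D → Realizable (S ++ T ++ D) (sumℤ S) E
  sum-realizable E⊆D {x} {y} {z} x∈ y∈ z∈ =
    subst (_∈ _) (regroup (sumℤ S) x y z)
      (subsetSums-++ S (sum-minus∈subsetSums x∈) (subsetSums-++ T (∈⇒∈subsetSums y∈) (E⊆D z∈)))
    where
    regroup : ∀ s x y z → s - x + (y + z) ≡ s + (y - x) + z
    regroup = solve-∀

three-way-split : ∀ q (s : List ℤ) → 4 ℕ.* q ℕ.≤ length s →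
  ∃ λ S → ∃ λ T → ∃ λ D → s ≡ S ++ T ++ D × length S ≡ q × length T ≡ q × q ℕ.+ q ℕ.≤ length D
three-way-split q s 4q≤s with split-at q s (subst (ℕ._≤ length s) (four q) 4q≤s)
  where
  four : ∀ q → 4 ℕ.* q ≡ q ℕ.+ (q ℕ.+ (q ℕ.+ q))
  four = ℕSolver.solve-∀
... | S , R , refl , |S| , 3q≤R with split-at q R 3q≤R
...   | T , D , refl , |T| , 2q≤D = S , T , D , refl , |S| , |T| , 2q≤D

increasing-bound : ∀ q {s} → AllPairs ℤ._<_ s → Nonneg s → IsSidon s →
                   4 ℕ.* q ℕ.≤ length s → suc q ℕ.* (q ℕ.* q) ℕ.≤ ∣Σ*∣ s
increasing-bound q {s} increasing s≥0 sidon 4q≤s with three-way-split q s 4q≤s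
... | S , T , D , refl , |S| , |T| , 2q≤D with AllPairs-++⁻ S increasing
... | S-increasing , T++D-increasing , S<T++D with AllPairs-++⁻ T T++D-increasing
... | T-increasing , _ , T<D = begin
    suc q ℕ.* (q ℕ.* q)
  ≤⟨ ℕₚ.*-mono-≤ (s≤s (pairSums-length q D 2q≤D)) (ℕₚ.≤-reflexive (sym (cong₂ ℕ._*_ |S| |T|))) ⟩
    suc (length E) ℕ.* (length S ℕ.* length T)
  ≡⟨ sym (blocks-length (sumℤ S) E) ⟩
    length (blocks (sumℤ S) E)
  ≤⟨ ∣Σ*∣-lower {A = S ++ T ++ D} unique (blocks-⊆ (S ++ T ++ D) (sumℤ S) E realizable) ⟩
    ∣Σ*∣ (S ++ T ++ D)
  ∎
  where
  open ℕₚ.≤-Reasoning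
  open Blocks S T
  E : List ℤ
  E = pairSums D
  S#T : Disjoint S T
  S#T (x∈S , x∈T) = ℤₚ.<-irrefl refl (S<T++D x∈S (∈-++⁺ˡ x∈T))
  distinct : DistinctDifferences S T
  distinct = sidon⇒distinct-differences (sidon-⊆ (++⁺ʳ S (xs⊆xs++ys T D)) sidon) S#T
  unique : Unique (blocks (sumℤ S) E)
  unique = blocks-unique (sumℤ S) E
    (AllPairs.map ℤₚ.<⇒≢ S-increasing) (AllPairs.map ℤₚ.<⇒≢ T-increasing) distinct
    (s≥0 ∘ ∈-++⁺ˡ) (s≥0 ∘ ∈-++⁺ʳ S ∘ ∈-++⁺ˡ)
    (pairSums-spread D (s≥0 ∘ ∈-++⁺ʳ S ∘ ∈-++⁺ʳ T) (λ x∈ d∈ → S<T++D x∈ (∈-++⁺ʳ T d∈)) T<D)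
  realizable : Realizable (S ++ T ++ D) (sumℤ S) E
  realizable = sum-realizable {D} {E} (pairSums-subsetSums D)

module _ where
  open DecTotalOrder ℤₚ.≤-decTotalOrder using (totalOrder)
  open import Data.List.Sort ℤₚ.≤-decTotalOrder using (sort; sort-↭; sort-↗)

  -- The bound for nonnegative Sidon sets: sorting a duplicate-free list
  -- makes it strictly increasing without changing its subset sums.

  nonneg-bound : ∀ q {Q} → Unique Q → Nonneg Q → IsSidon Q →
                 4 ℕ.* q ℕ.≤ length Q → suc q ℕ.* (q ℕ.* q) ℕ.≤ ∣Σ*∣ Q
  nonneg-bound q {Q} uQ Q≥0 sidon 4q≤Q = ℕₚ.≤-trans
    (increasing-bound q increasing (Q≥0 ∘ ∈-resp-↭ σ) (sidon-⊆ (∈-resp-↭ σ) sidon)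
      (subst (4 ℕ.* q ℕ.≤_) (sym (↭-length σ)) 4q≤Q))
    (∣Σ*∣-mono {Q} {sort Q} id id (subsetSums-↭ σ))
    where
    σ : sort Q ↭ Q
    σ = sort-↭ Q
    increasing : AllPairs ℤ._<_ (sort Q)
    increasing = AllPairs.zipWith (λ (x≤y , x≢y) → ℤₚ.≤∧≢⇒< x≤y x≢y)
      (Sorted⇒AllPairs totalOrder (sort-↗ Q) , Permutationₛ.Unique-resp-↭ (setoid ℤ) (↭⇒↭ₛ (↭-sym σ)) uQ)

length-filter-split : ∀ {A : Set} {P : A → Set} (P? : Decidable P) xs →
                      length xs ≡ length (filter P? xs) ℕ.+ length (filter (∁? P?) xs)
length-filter-split P? [] = refl
length-filter-split P? (x ∷ xs) with P? x
... | yes _ = cong suc (length-filter-split P? xs)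
... | no _ = trans (cong suc (length-filter-split P? xs)) (sym (ℕₚ.+-suc _ _))

record NonnegativeHalf (A : List ℤ) : Set where
  field
    Q : List ℤ
    unique : Unique Q
    nonneg : Nonneg Q
    sidon : IsSidon Q
    large : length A ℕ.≤ length Q ℕ.+ length Q
    fewer-sums : ∣Σ*∣ Q ℕ.≤ ∣Σ*∣ A

module _ (A : List ℤ) (uA : Unique A) (sidonA : IsSidon A) where
  private
    P N : List ℤ
    P = filter (0ℤ ℤ.≤?_) A
    N = filter (∁? (0ℤ ℤ.≤?_)) A

    nonneg-part : length N ℕ.≤ length P → NonnegativeHalf A
    nonneg-part N≤P = record
      { Q = P
      ; unique = Uniqueₚ.filter⁺ (0ℤ ℤ.≤?_) uA
      ; nonneg = proj₂ ∘ ∈-filter⁻ (0ℤ ℤ.≤?_) {xs = A}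
      ; sidon = sidon-⊆ (proj₁ ∘ ∈-filter⁻ (0ℤ ℤ.≤?_) {xs = A}) sidonA
      ; large = subst (ℕ._≤ length P ℕ.+ length P) (sym (length-filter-split (0ℤ ℤ.≤?_) A))
                  (ℕₚ.+-monoʳ-≤ (length P) N≤P)
      ; fewer-sums = ∣Σ*∣-mono {A} {P} id id (subsetSums-⊑ (filter-⊆ (0ℤ ℤ.≤?_) A))
      }

    negated-part : length P ℕ.≤ length N → NonnegativeHalf A
    negated-part P≤N = record
      { Q = map -_ N
      ; unique = Uniqueₚ.map⁺ ℤₚ.neg-injective (Uniqueₚ.filter⁺ (∁? (0ℤ ℤ.≤?_)) uA)
      ; nonneg = negated≥0
      ; sidon = sidon-neg (sidon-⊆ (proj₁ ∘ ∈-filter⁻ (∁? (0ℤ ℤ.≤?_)) {xs = A}) sidonA)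
      ; large = subst₂ ℕ._≤_ (sym (length-filter-split (0ℤ ℤ.≤?_) A))
                  (cong₂ ℕ._+_ (sym (length-map -_ N)) (sym (length-map -_ N)))
                  (ℕₚ.+-monoˡ-≤ (length N) P≤N)
      ; fewer-sums = ∣Σ*∣-mono {A} {map -_ N} -_ ℤₚ.neg-injective
                       (subsetSums-⊑ (filter-⊆ (∁? (0ℤ ℤ.≤?_)) A) ∘ subsetSums-neg N)
      }
      where
      negated≥0 : Nonneg (map -_ N)
      negated≥0 v∈ with ∈-map⁻ -_ v∈
      ... | a , a∈N , refl = ℤₚ.<⇒≤ (ℤₚ.neg-mono-< (ℤₚ.≰⇒> (proj₂ (∈-filter⁻ (∁? (0ℤ ℤ.≤?_)) {xs = A} a∈N))))

  nonnegative-half : NonnegativeHalf A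
  nonnegative-half with ℕₚ.≤-total (length N) (length P)
  ... | inj₁ N≤P = nonneg-part N≤P
  ... | inj₂ P≤N = negated-part P≤N

-- (q+1)³ ≤ 4(q+1)q² for q ≥ 1; for q = 0 the bound follows from k ≥ 1.
succ-cube-≤ : ∀ q {k} → suc q ℕ.* (q ℕ.* q) ℕ.≤ k → 1 ℕ.≤ k → suc q ^ 3 ℕ.≤ 4 ℕ.* k
succ-cube-≤ zero _ 1≤k = ℕₚ.≤-trans 1≤k (ℕₚ.m≤n*m _ 4)
succ-cube-≤ (suc r) {k} bound _ = begin
    suc q ^ 3                                ≡⟨ cube (suc q) ⟩
    suc q ℕ.* (suc q ℕ.* suc q)              ≤⟨ ℕₚ.*-monoʳ-≤ (suc q) (ℕₚ.*-mono-≤ q+1≤2q q+1≤2q) ⟩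
    suc q ℕ.* ((q ℕ.+ q) ℕ.* (q ℕ.+ q))      ≡⟨ regroup q ⟩
    4 ℕ.* (suc q ℕ.* (q ℕ.* q))              ≤⟨ ℕₚ.*-monoʳ-≤ 4 bound ⟩
    4 ℕ.* k                                  ∎
  where
  open ℕₚ.≤-Reasoning
  q : ℕ
  q = suc r
  q+1≤2q : suc q ℕ.≤ q ℕ.+ q
  q+1≤2q = s≤s (ℕₚ.m≤n+m q r)
  -- n ^ 3 unfolds to n * (n * (n * 1)).
  cube : ∀ n → n ℕ.* (n ℕ.* (n ℕ.* 1)) ≡ n ℕ.* (n ℕ.* n)
  cube = ℕSolver.solve-∀
  regroup : ∀ q → suc q ℕ.* ((q ℕ.+ q) ℕ.* (q ℕ.+ q)) ≡ 4 ℕ.* (suc q ℕ.* (q ℕ.* q))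
  regroup = ℕSolver.solve-∀

-- With q = ⌊m/4⌋ we have n ≤ 2m < 8(q+1), hence n³ ≤ 512 (q+1)³ ≤ 2048 k.
cube-bound : ∀ n m {k} → n ℕ.≤ m ℕ.+ m → suc (m div 4) ℕ.* (m div 4 ℕ.* (m div 4)) ℕ.≤ k →
             1 ℕ.≤ k → n ^ 3 ℕ.≤ 2048 ℕ.* k
cube-bound n m {k} n≤2m bound 1≤k = begin
    n ^ 3                     ≤⟨ ℕₚ.^-monoˡ-≤ 3 n≤8[q+1] ⟩
    (8 ℕ.* suc q) ^ 3         ≡⟨ expand (suc q) ⟩
    512 ℕ.* suc q ^ 3         ≤⟨ ℕₚ.*-monoʳ-≤ 512 (succ-cube-≤ q bound 1≤k) ⟩
    512 ℕ.* (4 ℕ.* k)         ≡⟨ sym (ℕₚ.*-assoc 512 4 k) ⟩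
    2048 ℕ.* k                ∎
  where
  open ℕₚ.≤-Reasoning
  q : ℕ
  q = m div 4
  m≤4[q+1] : m ℕ.≤ suc q ℕ.* 4
  m≤4[q+1] = ℕₚ.<⇒≤ (subst (ℕ._< suc q ℕ.* 4) (sym (m≡m%n+[m/n]*n m 4)) (ℕₚ.+-monoˡ-< (q ℕ.* 4) (m%n<n m 4)))
  double : ∀ p → p ℕ.* 4 ℕ.+ p ℕ.* 4 ≡ 8 ℕ.* p
  double = ℕSolver.solve-∀
  n≤8[q+1] : n ℕ.≤ 8 ℕ.* suc q
  n≤8[q+1] = ℕₚ.≤-trans n≤2m (ℕₚ.≤-trans (ℕₚ.+-mono-≤ m≤4[q+1] m≤4[q+1]) (ℕₚ.≤-reflexive (double (suc q))))
  expand : ∀ p → (8 ℕ.* p) ℕ.* ((8 ℕ.* p) ℕ.* ((8 ℕ.* p) ℕ.* 1)) ≡ 512 ℕ.* (p ℕ.* (p ℕ.* (p ℕ.* 1)))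
  expand = ℕSolver.solve-∀

sidon-cube-bound : ∀ A → Unique A → IsSidon A → length A ^ 3 ℕ.≤ 2048 ℕ.* ∣Σ*∣ A
sidon-cube-bound A uA sidon-A = cube-bound (length A) m large
  (ℕₚ.≤-trans (nonneg-bound q unique nonneg sidon 4q≤m) fewer-sums) (∣Σ*∣-positive A)
  where
  open NonnegativeHalf (nonnegative-half A uA sidon-A)
  m q : ℕ
  m = length Q
  q = m div 4
  4q≤m : 4 ℕ.* q ℕ.≤ m
  4q≤m = subst (ℕ._≤ m) (ℕₚ.*-comm q 4) (m/n*n≤m m 4)

-- c = 1/2048
c : ℚ
c = mkℚ (+ 1) 2047 (1-coprimeTo 2048)

0<c : 0ℚ < c
0<c = ℚ.*<* (ℤ.+<+ (s≤s z≤n))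

/1-normal : ∀ a → (+ a) / 1 ≡ mkℚ (+ a) 0 (coprime-sym (1-coprimeTo a))
/1-normal a = normalize-coprime (coprime-sym (1-coprimeTo a))

scale-to-ℚ : ∀ a k → a ℕ.≤ 2048 ℕ.* k → c * ((+ a) / 1) ≤ (+ k) / 1
scale-to-ℚ a k a≤2048k rewrite /1-normal a | /1-normal k =
  toℚᵘ-cancel-≤ (ℚᵘₚ.≤-respˡ-≃ (ℚᵘₚ.≃-sym (toℚᵘ-homo-* c a/1)) (ℚᵘ.*≤* cross-multiplied))
  where
  open ℤₚ.≤-Reasoning
  a/1 : ℚ
  a/1 = mkℚ (+ a) 0 (coprime-sym (1-coprimeTo a))
  unit : ∀ x → (+ 1 ℤ.* x) ℤ.* + 1 ≡ x
  unit = solve-∀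
  cross-multiplied : (+ 1 ℤ.* + a) ℤ.* + 1 ℤ.≤ + k ℤ.* + 2048
  cross-multiplied = begin
    (+ 1 ℤ.* + a) ℤ.* + 1   ≡⟨ unit (+ a) ⟩
    + a                     ≤⟨ ℤ.+≤+ a≤2048k ⟩
    + (2048 ℕ.* k)          ≡⟨ cong +_ (ℕₚ.*-comm 2048 k) ⟩
    + (k ℕ.* 2048)          ≡⟨ ℤₚ.pos-* k 2048 ⟩
    + k ℤ.* + 2048          ∎

theorem4 : ∃ λ (c : ℚ) → 0ℚ < c × ((A : List ℤ) → Unique A → IsSidon A → c * ((+ (length A ^ 3)) / 1) ≤ (+ ∣Σ*∣ A) / 1)
theorem4 = c , 0<c , λ A uA sidon →
  scale-to-ℚ (length A ^ 3) (∣Σ*∣ A) (sidon-cube-bound A uA sidon)
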